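{- Let $A$ be a commutative ring with $2\in A^\times$, $(R,*)$ an involutive $A$-algebra with a weak symplectic determinant law $(D,P)$. Then for every commutative $A$-algebra $B$, every $x\in R\otimes_AB$ and every $y\in R^+\otimes_AB$ such that $P_B(y)$ is a non-zero-divisor in $B$, we have $P_B(xyx^*)=D_B(x)P_B(y)$.
   Context: An involutive $A$-algebra is a unital associative $A$-algebra with $A$-linear anti-involution $*$; $R^+=\{x:x^*=x\}$. A polynomial law is a family $P_B$ natural in commutative $A$-algebras $B$, homogeneous of degree $n$ if $P_B(bx)=b^nP_B(x)$. A $2d$-dimensional weak symplectic determinant law is a pair $(D,P)$: $D\colon R\to A$ homogeneous of degree $2d$, multiplicative ($D_B(1)=1$, $D_B(xy)=D_B(x)D_B(y)$), $D_B(x^*)=D_B(x)$; $P\colon R^+\to A$ homogeneous of degree $d$ with $P_B(x)^2=D_B(x)$ for $x\in R^+\otimes_AB$ and $P_A(1)=1$. -}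

module Defs where

open import Level using (Level; suc)
open import Data.Nat using (ℕ; zero) renaming (suc to sucℕ)
import Data.Nat
open import Data.Product using (Σ; _,_; proj₁; proj₂)
open import Algebra.Bundles using (CommutativeRing; Ring)
open import Algebra.Morphism.Structures using (module RingMorphisms)
import Algebra.Morphism.Construct.Identity as IdM

module _ {ℓ : Level} (A : CommutativeRing ℓ ℓ) where

  private module A = CommutativeRing A

  record CommAlg : Set (suc ℓ) where
    field
      ring  : CommutativeRing ℓ ℓ
      φ     : A.Carrier → CommutativeRing.Carrier ring
      φ-hom : RingMorphisms.IsRingHomomorphism A.rawRing (CommutativeRing.rawRing ring) φ
    open CommutativeRing ring public hiding (ring)

  selfAlg : CommAlg
  selfAlg = record
    { ring = A ; φ = λ a → a
    ; φ-hom = IdM.isRingHomomorphism A.rawRing A.refl }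

  record AlgHom (B B′ : CommAlg) : Set ℓ where
    private
      module B = CommAlg B
      module B′ = CommAlg B′
    field
      f     : B.Carrier → B′.Carrier
      f-hom : RingMorphisms.IsRingHomomorphism B.rawRing B′.rawRing f
      f-φ   : ∀ a → f (B.φ a) B′.≈ B′.φ a

  pow : (B : CommAlg) → CommAlg.Carrier B → ℕ → CommAlg.Carrier B
  pow B b zero = CommAlg.1# B
  pow B b (sucℕ n) = CommAlg._*_ B b (pow B b n)

  record InvAlg : Set (suc ℓ) where
    field
      ring : Ring ℓ ℓ
    open Ring ring public
    infixr 7 _·_
    field
      _·_      : A.Carrier → Carrier → Carrier
      ·-cong   : ∀ {a a′ x x′} → a A.≈ a′ → x ≈ x′ → a · x ≈ a′ · x′
      ·-distʳ  : ∀ a b x → (a A.+ b) · x ≈ a · x + b · x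
      ·-distˡ  : ∀ a x y → a · (x + y) ≈ a · x + a · y
      ·-assoc  : ∀ a b x → (a A.* b) · x ≈ a · (b · x)
      ·-identity : ∀ x → A.1# · x ≈ x
      ·-*ˡ     : ∀ a x y → (a · x) * y ≈ a · (x * y)
      ·-*ʳ     : ∀ a x y → x * (a · y) ≈ a · (x * y)
      _⋆       : Carrier → Carrier
      ⋆-cong   : ∀ {x y} → x ≈ y → x ⋆ ≈ y ⋆
      ⋆-+      : ∀ x y → (x + y) ⋆ ≈ x ⋆ + y ⋆
      ⋆-*      : ∀ x y → (x * y) ⋆ ≈ (y ⋆) * (x ⋆)
      ⋆-invol  : ∀ x → (x ⋆) ⋆ ≈ x
      ⋆-·      : ∀ a x → (a · x) ⋆ ≈ a · (x ⋆)

  -- Data of an A-module (carrier, equality, addition, scalar action);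
  -- only used as input to the tensor-product construction.

  record ModData : Set (suc ℓ) where
    field
      Carrier : Set ℓ
      _≈_     : Carrier → Carrier → Set ℓ
      _+_     : Carrier → Carrier → Carrier
      _·_     : A.Carrier → Carrier → Carrier

  -- Tensor product M ⊗_A B, as formal Z-linear combinations of pure tensors
  -- modulo the (setoid) congruence generated by the abelian-group laws,
  -- biadditivity and A-balancedness.

  module Tensor (M : ModData) (B : CommAlg) where
    private
      module M = ModData M
      module B = CommAlg B

    infixl 6 _⊕_
    data Tm : Set ℓ where
      _⊗_ : M.Carrier → B.Carrier → Tm
      𝟘   : Tm
      _⊕_ : Tm → Tm → Tm
      ⊖_  : Tm → Tm

    infix 4 _∼_
    data _∼_ : Tm → Tm → Set ℓ where
      ∼-refl  : ∀ {s} → s ∼ s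
      ∼-sym   : ∀ {s t} → s ∼ t → t ∼ s
      ∼-trans : ∀ {s t u} → s ∼ t → t ∼ u → s ∼ u
      ⊗-cong  : ∀ {m m′ b b′} → m M.≈ m′ → b B.≈ b′ → (m ⊗ b) ∼ (m′ ⊗ b′)
      ⊕-cong  : ∀ {s s′ t t′} → s ∼ s′ → t ∼ t′ → s ⊕ t ∼ s′ ⊕ t′
      ⊖-cong  : ∀ {s s′} → s ∼ s′ → ⊖ s ∼ ⊖ s′
      ⊕-assoc : ∀ s t u → (s ⊕ t) ⊕ u ∼ s ⊕ (t ⊕ u)
      ⊕-comm  : ∀ s t → s ⊕ t ∼ t ⊕ s
      ⊕-idˡ   : ∀ s → 𝟘 ⊕ s ∼ s
      ⊕-invˡ  : ∀ s → (⊖ s) ⊕ s ∼ 𝟘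
      ⊗-addˡ  : ∀ m m′ b → ((m M.+ m′) ⊗ b) ∼ (m ⊗ b) ⊕ (m′ ⊗ b)
      ⊗-addʳ  : ∀ m b b′ → (m ⊗ (b B.+ b′)) ∼ (m ⊗ b) ⊕ (m ⊗ b′)
      ⊗-bal   : ∀ a m b → ((a M.· m) ⊗ b) ∼ (m ⊗ (B.φ a B.* b))

    _⊙_ : B.Carrier → Tm → Tm
    b ⊙ (m ⊗ b′) = m ⊗ (b B.* b′)
    b ⊙ 𝟘 = 𝟘
    b ⊙ (s ⊕ t) = (b ⊙ s) ⊕ (b ⊙ t)
    b ⊙ (⊖ s) = ⊖ (b ⊙ s)

  baseChange : (M : ModData) {B B′ : CommAlg} → AlgHom B B′ →
               Tensor.Tm M B → Tensor.Tm M B′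
  baseChange M {B} {B′} h (Tensor._⊗_ m b) = Tensor._⊗_ m (AlgHom.f h b)
  baseChange M {B} {B′} h Tensor.𝟘 = Tensor.𝟘
  baseChange M {B} {B′} h (Tensor._⊕_ s t) =
    Tensor._⊕_ (baseChange M h s) (baseChange M h t)
  baseChange M {B} {B′} h (Tensor.⊖_ s) = Tensor.⊖_ (baseChange M h s)

  record HomPolyLaw (M : ModData) (n : ℕ) : Set (suc ℓ) where
    field
      law     : (B : CommAlg) → Tensor.Tm M B → CommAlg.Carrier B
      law-cong : ∀ B {s t} → Tensor._∼_ M B s t →
                 CommAlg._≈_ B (law B s) (law B t)
      natural : ∀ {B B′} (h : AlgHom B B′) (t : Tensor.Tm M B) →
                CommAlg._≈_ B′ (law B′ (baseChange M h t)) (AlgHom.f h (law B t))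
      homogeneous : ∀ B (b : CommAlg.Carrier B) (t : Tensor.Tm M B) →
                CommAlg._≈_ B (law B (Tensor._⊙_ M B b t))
                              (CommAlg._*_ B (pow B b n) (law B t))

  module _ (R : InvAlg) where
    private module R = InvAlg R

    Rmod : ModData
    Rmod = record { Carrier = R.Carrier ; _≈_ = R._≈_ ; _+_ = R._+_ ; _·_ = R._·_ }

    Sym : Set ℓ
    Sym = Σ R.Carrier (λ x → x R.⋆ R.≈ x)

    R⁺mod : ModData
    R⁺mod = record
      { Carrier = Sym
      ; _≈_ = λ x y → proj₁ x R.≈ proj₁ y
      ; _+_ = λ { (x , p) (y , q) →
                 (x R.+ y) , R.trans (R.⋆-+ x y) (R.+-cong p q) }
      ; _·_ = λ { a (x , p) →
                 (a R.· x) , R.trans (R.⋆-· a x) (R.·-cong A.refl p) }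
      }

    module _ (B : CommAlg) where
      private module B = CommAlg B
      open Tensor Rmod B

      mulPure : R.Carrier → B.Carrier → Tm → Tm
      mulPure r b (r′ ⊗ b′) = (r R.* r′) ⊗ (b B.* b′)
      mulPure r b 𝟘 = 𝟘
      mulPure r b (s ⊕ t) = mulPure r b s ⊕ mulPure r b t
      mulPure r b (⊖ s) = ⊖ (mulPure r b s)

      _⊛_ : Tm → Tm → Tm
      (r ⊗ b) ⊛ t = mulPure r b t
      𝟘 ⊛ t = 𝟘
      (s ⊕ s′) ⊛ t = (s ⊛ t) ⊕ (s′ ⊛ t)
      (⊖ s) ⊛ t = ⊖ (s ⊛ t)

      one : Tm
      one = R.1# ⊗ B.1#

      star : Tm → Tm
      star (r ⊗ b) = (r R.⋆) ⊗ b
      star 𝟘 = 𝟘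
      star (s ⊕ t) = star s ⊕ star t
      star (⊖ s) = ⊖ (star s)

      incl : Tensor.Tm R⁺mod B → Tm
      incl (Tensor._⊗_ x b) = proj₁ x ⊗ b
      incl Tensor.𝟘 = 𝟘
      incl (s Tensor.⊕ t) = incl s ⊕ incl t
      incl (Tensor.⊖ s) = ⊖ (incl s)

      one⁺ : Tensor.Tm R⁺mod B
      one⁺ = Tensor._⊗_ (R.1# , 1⋆≈1) B.1#
        where
        1⋆≈1 : R.1# R.⋆ R.≈ R.1#
        1⋆≈1 = R.trans (R.sym (R.*-identityʳ (R.1# R.⋆)))
               (R.trans (R.*-congˡ (R.sym (R.⋆-invol R.1#)))
               (R.trans (R.sym (R.⋆-* (R.1# R.⋆) R.1#))
               (R.trans (R.⋆-cong (R.*-identityʳ (R.1# R.⋆)))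
                        (R.⋆-invol R.1#))))

      -- When ½ is the inverse of 2 this is the
      -- canonical identification of (R ⊗_A B)⁺ with R⁺ ⊗_A B (inverse to incl
      -- on symmetric elements).
      symm : (½ : A.Carrier) → Tm → Tensor.Tm R⁺mod B
      symm ½ (r ⊗ b) = Tensor._⊗_ ((½ R.· (r R.+ r R.⋆)) , pf) b
        where
        pf : (½ R.· (r R.+ r R.⋆)) R.⋆ R.≈ ½ R.· (r R.+ r R.⋆)
        pf = R.trans (R.⋆-· ½ (r R.+ r R.⋆))
             (R.·-cong A.refl
               (R.trans (R.⋆-+ r (r R.⋆))
               (R.trans (R.+-congˡ (R.⋆-invol r))
                        (R.+-comm (r R.⋆) r))))
      symm ½ 𝟘 = Tensor.𝟘
      symm ½ (s ⊕ t) = Tensor._⊕_ (symm ½ s) (symm ½ t)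
      symm ½ (⊖ s) = Tensor.⊖_ (symm ½ s)

  record WeakSympDetLaw (R : InvAlg) (d : ℕ) : Set (suc ℓ) where
    field
      D : HomPolyLaw (Rmod R) (2 Data.Nat.* d)
      P : HomPolyLaw (R⁺mod R) d
    open HomPolyLaw D renaming (law to D_)
    open HomPolyLaw P renaming (law to P_)
    field
      D-one  : ∀ B → CommAlg._≈_ B (D_ B (one R B)) (CommAlg.1# B)
      D-mult : ∀ B x y → CommAlg._≈_ B (D_ B (_⊛_ R B x y))
                                        (CommAlg._*_ B (D_ B x) (D_ B y))
      D-star : ∀ B x → CommAlg._≈_ B (D_ B (star R B x)) (D_ B x)
      P-sq   : ∀ B y → CommAlg._≈_ B (CommAlg._*_ B (P_ B y) (P_ B y))
                                      (D_ B (incl R B y))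
      P-one  : P_ selfAlg (one⁺ R selfAlg) A.≈ A.1#

-- Deform x along X(T) = (1 - T)·1 + T·x in R ⊗_A B[T] and keep y constant.  The polynomials
-- f = P(X y X⋆) and g = D(X) P(y) have equal squares, because P² = D and D is multiplicative and
-- ⋆-invariant; at T = 0 both are P(y).  As P(y) and 2 are non-zero-divisors in B, f = g, and
-- evaluating at T = 1 gives the claim (naturality of D and P makes evaluation commute with the laws).
module Submission where

open import Level using (Level)
open import Data.Nat using (ℕ; zero; suc)
open import Data.List using (List; []; _∷_)
open import Data.Product using (Σ; _,_; proj₁; proj₂)
open import Defs
open import Algebra.Bundles using (CommutativeRing; Ring; RawRing; AbelianGroup)
open import Algebra.Structures using (IsCommutativeRing)
open import Algebra.Morphism.Structures using (module RingMorphisms)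
import Algebra.Properties.Group as GroupProperties
import Algebra.Properties.AbelianGroup as AbelianGroupProperties
import Algebra.Properties.RingWithoutOne as RingWithoutOneProperties
import Algebra.Properties.CommutativeSemigroup as CommutativeSemigroupProperties
import Algebra.Solver.Ring.NaturalCoefficients.Default as NaturalSolver
import Algebra.Morphism.Construct.Composition as Composition
import Relation.Binary.Reasoning.Setoid as SetoidReasoning

module CommutativeRingFacts {c : Level} (CR : CommutativeRing c c) where
  open CommutativeRing CR
  open NaturalSolver commutativeSemiring
  open SetoidReasoning setoid

  NonZeroDivisor : Carrier → Set c
  NonZeroDivisor a = ∀ b → a * b ≈ 0# → b ≈ 0#

  IsHalf : Carrier → Set c
  IsHalf h = h * (1# + 1#) ≈ 1#

  x²≈y²⇒[x-y][x+y]≈0 : ∀ x y → x * x ≈ y * y → (x - y) * (x + y) ≈ 0#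
  x²≈y²⇒[x-y][x+y]≈0 x y x²≈y² = begin
    (x - y) * (x + y)                    ≈⟨ solve 3 (λ x y z → (x :+ z) :* (x :+ y) := (x :* x :+ z :* y) :+ (z :+ y) :* x) refl x y (- y) ⟩
    (x * x + - y * y) + (- y + y) * x    ≈⟨ +-cong (+-congʳ x²≈y²) (*-congʳ (-‿inverseˡ y)) ⟩
    (y * y + - y * y) + 0# * x           ≈⟨ +-cong (trans (sym (distribʳ y y (- y))) (trans (*-congʳ (-‿inverseʳ y)) (zeroˡ y))) (zeroˡ x) ⟩
    0# + 0#                              ≈⟨ +-identityʳ 0# ⟩
    0#                                   ∎

  NonZeroDivisor-resp : ∀ {a b} → a ≈ b → NonZeroDivisor a → NonZeroDivisor b
  NonZeroDivisor-resp a≈b regular x bx≈0 = regular x (trans (*-congʳ a≈b) bx≈0)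

  NonZeroDivisor-* : ∀ {a b} → NonZeroDivisor a → NonZeroDivisor b → NonZeroDivisor (a * b)
  NonZeroDivisor-* {a} {b} a-regular b-regular x abx≈0 =
    b-regular x (a-regular (b * x) (trans (sym (*-assoc a b x)) abx≈0))

  IsHalf⇒NonZeroDivisor-2 : ∀ {h} → IsHalf h → NonZeroDivisor (1# + 1#)
  IsHalf⇒NonZeroDivisor-2 {h} h2≈1 x 2x≈0 = begin
    x                    ≈⟨ sym (*-identityˡ x) ⟩
    1# * x               ≈⟨ *-congʳ (sym h2≈1) ⟩
    h * (1# + 1#) * x    ≈⟨ *-assoc h _ x ⟩
    h * ((1# + 1#) * x)  ≈⟨ *-congˡ 2x≈0 ⟩
    h * 0#               ≈⟨ zeroʳ h ⟩
    0#                   ∎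

mkIsRingHomomorphism : ∀ {a ℓ₁ b ℓ₂} {R₁ : RawRing a ℓ₁} {R₂ : RawRing b ℓ₂}
  {f : RawRing.Carrier R₁ → RawRing.Carrier R₂} →
  (∀ {x y} → RawRing._≈_ R₁ x y → RawRing._≈_ R₂ (f x) (f y)) →
  (∀ x y → RawRing._≈_ R₂ (f (RawRing._+_ R₁ x y)) (RawRing._+_ R₂ (f x) (f y))) →
  (∀ x y → RawRing._≈_ R₂ (f (RawRing._*_ R₁ x y)) (RawRing._*_ R₂ (f x) (f y))) →
  RawRing._≈_ R₂ (f (RawRing.0# R₁)) (RawRing.0# R₂) →
  RawRing._≈_ R₂ (f (RawRing.1# R₁)) (RawRing.1# R₂) →
  (∀ x → RawRing._≈_ R₂ (f (RawRing.-_ R₁ x)) (RawRing.-_ R₂ (f x))) →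
  RingMorphisms.IsRingHomomorphism R₁ R₂ f
mkIsRingHomomorphism cong +-homo *-homo 0#-homo 1#-homo -‿homo = record
  { isSemiringHomomorphism = record
    { isNearSemiringHomomorphism = record
      { +-isMonoidHomomorphism = record
        { isMagmaHomomorphism = record { isRelHomomorphism = record { cong = cong } ; homo = +-homo }
        ; ε-homo = 0#-homo }
      ; *-homo = *-homo }
    ; 1#-homo = 1#-homo }
  ; -‿homo = -‿homo }

module Polynomials {c : Level} (CR : CommutativeRing c c) where
  open CommutativeRing CR hiding (zero)
  open NaturalSolver commutativeSemiring
  open SetoidReasoning setoid
  open GroupProperties +-group using (ε⁻¹≈ε)
  open AbelianGroupProperties +-abelianGroup using (⁻¹-∙-comm)
  open RingWithoutOneProperties (Ring.ringWithoutOne ring) using (-‿distribʳ-*)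
  open CommutativeRingFacts CR

  Poly : Set c
  Poly = List Carrier

  coeff : Poly → ℕ → Carrier
  coeff []      _       = 0#
  coeff (a ∷ p) zero    = a
  coeff (a ∷ p) (suc n) = coeff p n

  infix 4 _≋_
  record _≋_ (p q : Poly) : Set c where
    constructor mk
    field at : ∀ n → coeff p n ≈ coeff q n
  open _≋_ public

  ≋-refl : ∀ {p} → p ≋ p
  ≋-refl = mk λ n → refl

  ≋-sym : ∀ {p q} → p ≋ q → q ≋ p
  ≋-sym e = mk λ n → sym (at e n)

  ≋-trans : ∀ {p q r} → p ≋ q → q ≋ r → p ≋ r
  ≋-trans e f = mk λ n → trans (at e n) (at f n)

  ∷-cong : ∀ {a b p q} → a ≈ b → p ≋ q → (a ∷ p) ≋ (b ∷ q)
  ∷-cong e f = mk λ { zero → e ; (suc n) → at f n }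

  ∷-injectiveʳ : ∀ {a b p q} → (a ∷ p) ≋ (b ∷ q) → p ≋ q
  ∷-injectiveʳ e = mk λ n → at e (suc n)

  ∷≋[]⇒≋[] : ∀ {a p} → (a ∷ p) ≋ [] → p ≋ []
  ∷≋[]⇒≋[] e = mk λ n → at e (suc n)

  infixl 6 _⊞_
  _⊞_ : Poly → Poly → Poly
  []      ⊞ q       = q
  (a ∷ p) ⊞ []      = a ∷ p
  (a ∷ p) ⊞ (b ∷ q) = (a + b) ∷ (p ⊞ q)

  infix 8 ⊟_
  ⊟_ : Poly → Poly
  ⊟ []      = []
  ⊟ (a ∷ p) = (- a) ∷ ⊟ p

  infixr 7 _·ₚ_
  _·ₚ_ : Carrier → Poly → Poly
  a ·ₚ []      = []
  a ·ₚ (b ∷ p) = (a * b) ∷ (a ·ₚ p)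

  shift : Poly → Poly
  shift p = 0# ∷ p

  infixl 7 _⊠_
  _⊠_ : Poly → Poly → Poly
  []      ⊠ q = []
  (a ∷ p) ⊠ q = (a ·ₚ q) ⊞ shift (p ⊠ q)

  1ₚ : Poly
  1ₚ = 1# ∷ []

  T : Poly
  T = 0# ∷ 1# ∷ []

  coeff-⊞ : ∀ p q n → coeff (p ⊞ q) n ≈ coeff p n + coeff q n
  coeff-⊞ []      q       n       = sym (+-identityˡ _)
  coeff-⊞ (a ∷ p) []      n       = sym (+-identityʳ _)
  coeff-⊞ (a ∷ p) (b ∷ q) zero    = refl
  coeff-⊞ (a ∷ p) (b ∷ q) (suc n) = coeff-⊞ p q n

  coeff-⊟ : ∀ p n → coeff (⊟ p) n ≈ - coeff p n
  coeff-⊟ []      n       = sym ε⁻¹≈ε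
  coeff-⊟ (a ∷ p) zero    = refl
  coeff-⊟ (a ∷ p) (suc n) = coeff-⊟ p n

  coeff-·ₚ : ∀ a p n → coeff (a ·ₚ p) n ≈ a * coeff p n
  coeff-·ₚ a []      n       = sym (zeroʳ a)
  coeff-·ₚ a (b ∷ p) zero    = refl
  coeff-·ₚ a (b ∷ p) (suc n) = coeff-·ₚ a p n

  coeff-⊠-∷ : ∀ a p q n → coeff ((a ∷ p) ⊠ q) n ≈ a * coeff q n + coeff (shift (p ⊠ q)) n
  coeff-⊠-∷ a p q n = trans (coeff-⊞ (a ·ₚ q) _ n) (+-congʳ (coeff-·ₚ a q n))

  ⊞-cong : ∀ {p p′ q q′} → p ≋ p′ → q ≋ q′ → p ⊞ q ≋ p′ ⊞ q′
  ⊞-cong {p} {p′} {q} {q′} e f = mk λ n →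
    trans (coeff-⊞ p q n) (trans (+-cong (at e n) (at f n)) (sym (coeff-⊞ p′ q′ n)))

  ⊟-cong : ∀ {p q} → p ≋ q → ⊟ p ≋ ⊟ q
  ⊟-cong {p} {q} e = mk λ n → trans (coeff-⊟ p n) (trans (-‿cong (at e n)) (sym (coeff-⊟ q n)))

  ·ₚ-cong : ∀ {a b p q} → a ≈ b → p ≋ q → a ·ₚ p ≋ b ·ₚ q
  ·ₚ-cong {a} {b} {p} {q} e f = mk λ n →
    trans (coeff-·ₚ a p n) (trans (*-cong e (at f n)) (sym (coeff-·ₚ b q n)))

  shift-cong : ∀ {p q} → p ≋ q → shift p ≋ shift q
  shift-cong = ∷-cong refl

  ⊞-assoc : ∀ p q r → (p ⊞ q) ⊞ r ≋ p ⊞ (q ⊞ r)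
  ⊞-assoc p q r = mk λ n → begin
    coeff ((p ⊞ q) ⊞ r) n                ≈⟨ trans (coeff-⊞ (p ⊞ q) r n) (+-congʳ (coeff-⊞ p q n)) ⟩
    (coeff p n + coeff q n) + coeff r n  ≈⟨ +-assoc _ _ _ ⟩
    coeff p n + (coeff q n + coeff r n)  ≈⟨ sym (trans (coeff-⊞ p (q ⊞ r) n) (+-congˡ (coeff-⊞ q r n))) ⟩
    coeff (p ⊞ (q ⊞ r)) n                ∎

  ⊞-comm : ∀ p q → p ⊞ q ≋ q ⊞ p
  ⊞-comm p q = mk λ n → trans (coeff-⊞ p q n) (trans (+-comm _ _) (sym (coeff-⊞ q p n)))

  ⊞-identityʳ : ∀ p → p ⊞ [] ≋ p
  ⊞-identityʳ p = mk λ n → trans (coeff-⊞ p [] n) (+-identityʳ _)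

  ⊟-inverseˡ : ∀ p → ⊟ p ⊞ p ≋ []
  ⊟-inverseˡ p = mk λ n → trans (coeff-⊞ (⊟ p) p n) (trans (+-congʳ (coeff-⊟ p n)) (-‿inverseˡ _))

  ⊟-inverseʳ : ∀ p → p ⊞ ⊟ p ≋ []
  ⊟-inverseʳ p = mk λ n → trans (coeff-⊞ p (⊟ p) n) (trans (+-congˡ (coeff-⊟ p n)) (-‿inverseʳ _))

  ⊠-zeroʳ : ∀ p → p ⊠ [] ≋ []
  ⊠-zeroʳ []      = ≋-refl
  ⊠-zeroʳ (a ∷ p) = mk λ { zero → refl ; (suc n) → at (⊠-zeroʳ p) n }

  ≋[]⇒⊠≋[] : ∀ p q → p ≋ [] → p ⊠ q ≋ []
  ≋[]⇒⊠≋[] []      q e = ≋-refl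
  ≋[]⇒⊠≋[] (a ∷ p) q e = mk λ n → begin
    coeff ((a ∷ p) ⊠ q) n                      ≈⟨ coeff-⊠-∷ a p q n ⟩
    a * coeff q n + coeff (shift (p ⊠ q)) n    ≈⟨ +-cong (trans (*-congʳ (at e zero)) (zeroˡ _)) (shifted-zero n) ⟩
    0# + 0#                                    ≈⟨ +-identityˡ 0# ⟩
    0#                                         ∎
    where
    shifted-zero : ∀ n → coeff (shift (p ⊠ q)) n ≈ 0#
    shifted-zero zero    = refl
    shifted-zero (suc n) = at (≋[]⇒⊠≋[] p q (∷≋[]⇒≋[] e)) n

  ⊠-congʳ : ∀ {p p′} q → p ≋ p′ → p ⊠ q ≋ p′ ⊠ q
  ⊠-congʳ {[]}    {[]}     q e = ≋-refl
  ⊠-congʳ {[]}    {b ∷ p′} q e = ≋-sym (≋[]⇒⊠≋[] (b ∷ p′) q (≋-sym e))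
  ⊠-congʳ {a ∷ p} {[]}     q e = ≋[]⇒⊠≋[] (a ∷ p) q e
  ⊠-congʳ {a ∷ p} {b ∷ p′} q e =
    ⊞-cong (·ₚ-cong (at e zero) ≋-refl) (shift-cong (⊠-congʳ q (∷-injectiveʳ e)))

  ⊠-distribʳ : ∀ r p q → (p ⊞ q) ⊠ r ≋ p ⊠ r ⊞ q ⊠ r
  ⊠-distribʳ r []      q       = ≋-refl
  ⊠-distribʳ r (a ∷ p) []      = ≋-sym (⊞-identityʳ _)
  ⊠-distribʳ r (a ∷ p) (b ∷ q) = mk λ n → begin
    coeff (((a + b) ∷ (p ⊞ q)) ⊠ r) n
      ≈⟨ trans (coeff-⊠-∷ (a + b) (p ⊞ q) r n) (+-congˡ (shifted n)) ⟩
    (a + b) * coeff r n + (coeff (shift (p ⊠ r)) n + coeff (shift (q ⊠ r)) n)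
      ≈⟨ solve 5 (λ a b x y z → (a :+ b) :* x :+ (y :+ z) := (a :* x :+ y) :+ (b :* x :+ z))
               refl a b (coeff r n) (coeff (shift (p ⊠ r)) n) (coeff (shift (q ⊠ r)) n) ⟩
    (a * coeff r n + coeff (shift (p ⊠ r)) n) + (b * coeff r n + coeff (shift (q ⊠ r)) n)
      ≈⟨ sym (trans (coeff-⊞ ((a ∷ p) ⊠ r) _ n) (+-cong (coeff-⊠-∷ a p r n) (coeff-⊠-∷ b q r n))) ⟩
    coeff ((a ∷ p) ⊠ r ⊞ (b ∷ q) ⊠ r) n
      ∎
    where
    shifted : ∀ n → coeff (shift ((p ⊞ q) ⊠ r)) n ≈ coeff (shift (p ⊠ r)) n + coeff (shift (q ⊠ r)) n
    shifted zero    = sym (+-identityˡ 0#)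
    shifted (suc n) = trans (at (⊠-distribʳ r p q) n) (coeff-⊞ (p ⊠ r) (q ⊠ r) n)

  shift-⊠ : ∀ p q → shift p ⊠ q ≋ shift (p ⊠ q)
  shift-⊠ p q = mk λ n → trans (coeff-⊠-∷ 0# p q n) (trans (+-congʳ (zeroˡ _)) (+-identityˡ _))

  ·ₚ-⊠ : ∀ a p q → (a ·ₚ p) ⊠ q ≋ a ·ₚ (p ⊠ q)
  ·ₚ-⊠ a []      q = ≋-refl
  ·ₚ-⊠ a (b ∷ p) q = mk λ n → begin
    coeff (((a * b) ∷ (a ·ₚ p)) ⊠ q) n
      ≈⟨ trans (coeff-⊠-∷ (a * b) (a ·ₚ p) q n) (+-congˡ (shifted n)) ⟩
    (a * b) * coeff q n + a * coeff (shift (p ⊠ q)) n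
      ≈⟨ solve 4 (λ a b x y → (a :* b) :* x :+ a :* y := a :* (b :* x :+ y)) refl a b (coeff q n) (coeff (shift (p ⊠ q)) n) ⟩
    a * (b * coeff q n + coeff (shift (p ⊠ q)) n)
      ≈⟨ sym (trans (coeff-·ₚ a ((b ∷ p) ⊠ q) n) (*-congˡ (coeff-⊠-∷ b p q n))) ⟩
    coeff (a ·ₚ ((b ∷ p) ⊠ q)) n
      ∎
    where
    shifted : ∀ n → coeff (shift ((a ·ₚ p) ⊠ q)) n ≈ a * coeff (shift (p ⊠ q)) n
    shifted zero    = sym (zeroʳ a)
    shifted (suc n) = trans (at (·ₚ-⊠ a p q) n) (coeff-·ₚ a (p ⊠ q) n)

  ⊠-∷ : ∀ p b q → p ⊠ (b ∷ q) ≋ (b ·ₚ p) ⊞ shift (p ⊠ q)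
  ⊠-∷ []      b q = mk λ { zero → refl ; (suc n) → refl }
  ⊠-∷ (a ∷ p) b q = ∷-cong (trans (+-identityʳ _) (trans (*-comm a b) (sym (+-identityʳ _)))) (mk λ n → begin
    coeff ((a ·ₚ q) ⊞ p ⊠ (b ∷ q)) n
      ≈⟨ trans (coeff-⊞ (a ·ₚ q) _ n) (+-congˡ (trans (at (⊠-∷ p b q) n) (coeff-⊞ (b ·ₚ p) _ n))) ⟩
    coeff (a ·ₚ q) n + (coeff (b ·ₚ p) n + coeff (shift (p ⊠ q)) n)
      ≈⟨ solve 3 (λ x y z → x :+ (y :+ z) := y :+ (x :+ z)) refl _ _ _ ⟩
    coeff (b ·ₚ p) n + (coeff (a ·ₚ q) n + coeff (shift (p ⊠ q)) n)
      ≈⟨ sym (trans (coeff-⊞ (b ·ₚ p) _ n) (+-congˡ (coeff-⊞ (a ·ₚ q) _ n))) ⟩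
    coeff ((b ·ₚ p) ⊞ (a ∷ p) ⊠ q) n
      ∎)

  ⊠-comm : ∀ p q → p ⊠ q ≋ q ⊠ p
  ⊠-comm []      q = ≋-sym (⊠-zeroʳ q)
  ⊠-comm (a ∷ p) q = ≋-trans (⊞-cong ≋-refl (shift-cong (⊠-comm p q))) (≋-sym (⊠-∷ q a p))

  ⊠-assoc : ∀ p q r → (p ⊠ q) ⊠ r ≋ p ⊠ (q ⊠ r)
  ⊠-assoc []      q r = ≋-refl
  ⊠-assoc (a ∷ p) q r =
    ≋-trans (⊠-distribʳ r (a ·ₚ q) (shift (p ⊠ q)))
            (⊞-cong (·ₚ-⊠ a q r) (≋-trans (shift-⊠ (p ⊠ q) r) (shift-cong (⊠-assoc p q r))))

  ⊠-identityˡ : ∀ p → 1ₚ ⊠ p ≋ p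
  ⊠-identityˡ p = mk λ n → trans (coeff-⊠-∷ 1# [] p n) (trans (+-cong (*-identityˡ _) (zero-tail n)) (+-identityʳ _))
    where
    zero-tail : ∀ n → coeff (shift ([] ⊠ p)) n ≈ 0#
    zero-tail zero    = refl
    zero-tail (suc n) = refl

  polynomialIsCommutativeRing : IsCommutativeRing _≋_ _⊞_ _⊠_ ⊟_ [] 1ₚ
  polynomialIsCommutativeRing = record
    { isRing = record
      { +-isAbelianGroup = record
        { isGroup = record
          { isMonoid = record
            { isSemigroup = record
              { isMagma = record
                { isEquivalence = record { refl = ≋-refl ; sym = ≋-sym ; trans = ≋-trans }
                ; ∙-cong = ⊞-cong }
              ; assoc = ⊞-assoc }
            ; identity = (λ p → ≋-refl) , ⊞-identityʳ }
          ; inverse = ⊟-inverseˡ , ⊟-inverseʳ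
          ; ⁻¹-cong = ⊟-cong }
        ; comm = ⊞-comm }
      ; *-cong = λ {p} {p′} {q} {q′} e f →
          ≋-trans (⊠-congʳ q e) (≋-trans (⊠-comm p′ q) (≋-trans (⊠-congʳ p′ f) (⊠-comm q′ p′)))
      ; *-assoc = ⊠-assoc
      ; *-identity = ⊠-identityˡ , (λ p → ≋-trans (⊠-comm p 1ₚ) (⊠-identityˡ p))
      ; distrib = (λ p q r → ≋-trans (⊠-comm p (q ⊞ r))
                   (≋-trans (⊠-distribʳ p q r) (⊞-cong (⊠-comm q p) (⊠-comm r p))))
                , ⊠-distribʳ }
    ; *-comm = ⊠-comm }

  polynomialRing : CommutativeRing c c
  polynomialRing = record { isCommutativeRing = polynomialIsCommutativeRing }

  eval : Carrier → Poly → Carrier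
  eval x []      = 0#
  eval x (a ∷ p) = a + x * eval x p

  eval-≋[] : ∀ x p → p ≋ [] → eval x p ≈ 0#
  eval-≋[] x []      e = refl
  eval-≋[] x (a ∷ p) e =
    trans (+-cong (at e zero) (trans (*-congˡ (eval-≋[] x p (∷≋[]⇒≋[] e))) (zeroʳ x))) (+-identityˡ 0#)

  eval-cong : ∀ x {p q} → p ≋ q → eval x p ≈ eval x q
  eval-cong x {[]}    {q}     e = sym (eval-≋[] x q (≋-sym e))
  eval-cong x {a ∷ p} {[]}    e = eval-≋[] x (a ∷ p) e
  eval-cong x {a ∷ p} {b ∷ q} e = +-cong (at e zero) (*-congˡ (eval-cong x (∷-injectiveʳ e)))

  eval-⊞ : ∀ x p q → eval x (p ⊞ q) ≈ eval x p + eval x q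
  eval-⊞ x []      q       = sym (+-identityˡ _)
  eval-⊞ x (a ∷ p) []      = sym (+-identityʳ _)
  eval-⊞ x (a ∷ p) (b ∷ q) = trans (+-congˡ (trans (*-congˡ (eval-⊞ x p q)) (distribˡ x _ _)))
    (solve 4 (λ a b u v → (a :+ b) :+ (u :+ v) := (a :+ u) :+ (b :+ v)) refl a b _ _)

  eval-·ₚ : ∀ x a p → eval x (a ·ₚ p) ≈ a * eval x p
  eval-·ₚ x a []      = sym (zeroʳ a)
  eval-·ₚ x a (b ∷ p) = trans (+-congˡ (*-congˡ (eval-·ₚ x a p)))
    (solve 4 (λ x a b e → a :* b :+ x :* (a :* e) := a :* (b :+ x :* e)) refl x a b _)

  eval-⊟ : ∀ x p → eval x (⊟ p) ≈ - eval x p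
  eval-⊟ x []      = sym ε⁻¹≈ε
  eval-⊟ x (a ∷ p) = trans (+-congˡ (trans (*-congˡ (eval-⊟ x p)) (sym (-‿distribʳ-* x _))))
    (⁻¹-∙-comm a (x * eval x p))

  eval-⊠ : ∀ x p q → eval x (p ⊠ q) ≈ eval x p * eval x q
  eval-⊠ x []      q = sym (zeroˡ _)
  eval-⊠ x (a ∷ p) q = begin
    eval x ((a ·ₚ q) ⊞ shift (p ⊠ q))            ≈⟨ eval-⊞ x (a ·ₚ q) (shift (p ⊠ q)) ⟩
    eval x (a ·ₚ q) + (0# + x * eval x (p ⊠ q))  ≈⟨ +-cong (eval-·ₚ x a q) (trans (+-identityˡ _) (*-congˡ (eval-⊠ x p q))) ⟩
    a * eval x q + x * (eval x p * eval x q)     ≈⟨ solve 4 (λ x a e f → a :* f :+ x :* (e :* f) := (a :+ x :* e) :* f) refl x a _ _ ⟩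
    (a + x * eval x p) * eval x q                ∎

  eval-constant : ∀ x a → eval x (a ∷ []) ≈ a
  eval-constant x a = trans (+-congˡ (zeroʳ x)) (+-identityʳ a)

  eval-T : ∀ x → eval x T ≈ x
  eval-T x = trans (+-identityˡ _) (trans (*-congˡ (eval-constant x 1#)) (*-identityʳ x))

  eval-0# : ∀ p → eval 0# p ≈ coeff p zero
  eval-0# []      = refl
  eval-0# (a ∷ p) = trans (+-congˡ (zeroˡ _)) (+-identityʳ a)

  evalIsRingHomomorphism : ∀ x → RingMorphisms.IsRingHomomorphism (CommutativeRing.rawRing polynomialRing) rawRing (eval x)
  evalIsRingHomomorphism x =
    mkIsRingHomomorphism (eval-cong x) (eval-⊞ x) (eval-⊠ x) refl (eval-constant x 1#) (eval-⊟ x)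

  ⊠≋[]⇒≋[] : ∀ p q → NonZeroDivisor (coeff q zero) → p ⊠ q ≋ [] → p ≋ []
  ⊠≋[]⇒≋[] []      q regular e = ≋-refl
  ⊠≋[]⇒≋[] (a ∷ p) q regular e = mk λ { zero → a≈0 ; (suc n) → at (⊠≋[]⇒≋[] p q regular p⊠q≋[]) n }
    where
    a≈0 : a ≈ 0#
    a≈0 = regular a (begin
      coeff q zero * a                   ≈⟨ solve 2 (λ a b → b :* a := a :* b :+ con 0) refl a (coeff q zero) ⟩
      a * coeff q zero + 0#              ≈⟨ sym (coeff-⊠-∷ a p q zero) ⟩
      coeff ((a ∷ p) ⊠ q) zero           ≈⟨ at e zero ⟩
      0#                                 ∎)
    p⊠q≋[] : p ⊠ q ≋ []
    p⊠q≋[] = mk λ n → begin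
      coeff (p ⊠ q) n                          ≈⟨ sym (+-identityˡ _) ⟩
      0# + coeff (p ⊠ q) n                     ≈⟨ +-congʳ (sym (trans (*-congʳ a≈0) (zeroˡ _))) ⟩
      a * coeff q (suc n) + coeff (p ⊠ q) n    ≈⟨ sym (coeff-⊠-∷ a p q (suc n)) ⟩
      coeff ((a ∷ p) ⊠ q) (suc n)              ≈⟨ at e (suc n) ⟩
      0#                                       ∎

  -- p² = q² gives (p - q)(p + q) = 0, and p + q has the regular constant term 2 p(0).
  ⊠-square-injective : NonZeroDivisor (1# + 1#) → ∀ p q → NonZeroDivisor (coeff p zero) →
                       coeff p zero ≈ coeff q zero → p ⊠ p ≋ q ⊠ q → p ≋ q
  ⊠-square-injective 2-regular p q p₀-regular p₀≈q₀ p²≋q² =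
    x∙y⁻¹≈ε⇒x≈y p q (⊠≋[]⇒≋[] (p ⊞ ⊟ q) (p ⊞ q) sum-regular (PolyFacts.x²≈y²⇒[x-y][x+y]≈0 p q p²≋q²))
    where
    module PolyFacts = CommutativeRingFacts polynomialRing
    open GroupProperties (CommutativeRing.+-group polynomialRing) using (x∙y⁻¹≈ε⇒x≈y)
    sum-regular : NonZeroDivisor (coeff (p ⊞ q) zero)
    sum-regular = NonZeroDivisor-resp
      (trans (solve 1 (λ x → (con 1 :+ con 1) :* x := x :+ x) refl (coeff p zero))
             (sym (trans (coeff-⊞ p q zero) (+-congˡ (sym p₀≈q₀)))))
      (NonZeroDivisor-* 2-regular p₀-regular)

module TensorProducts {ℓ : Level} (A : CommutativeRing ℓ ℓ) where
  private module A = CommutativeRing A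

  module TensorGroup (M : ModData A) (B : CommAlg A) where
    open Tensor A M B

    abelianGroup : AbelianGroup ℓ ℓ
    abelianGroup = record
      { Carrier = Tm ; _≈_ = _∼_ ; _∙_ = _⊕_ ; ε = 𝟘 ; _⁻¹ = ⊖_
      ; isAbelianGroup = record
        { isGroup = record
          { isMonoid = record
            { isSemigroup = record
              { isMagma = record
                { isEquivalence = record { refl = ∼-refl ; sym = ∼-sym ; trans = ∼-trans }
                ; ∙-cong = ⊕-cong }
              ; assoc = ⊕-assoc }
            ; identity = ⊕-idˡ , λ s → ∼-trans (⊕-comm s 𝟘) (⊕-idˡ s) }
          ; inverse = ⊕-invˡ , λ s → ∼-trans (⊕-comm s (⊖ s)) (⊕-invˡ s)
          ; ⁻¹-cong = ⊖-cong }
        ; comm = ⊕-comm } }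

    open AbelianGroup abelianGroup public using () renaming (identityʳ to ⊕-idʳ)
    open GroupProperties (AbelianGroup.group abelianGroup) public using (ε⁻¹≈ε; identityˡ-unique)
    open AbelianGroupProperties abelianGroup public using (⁻¹-∙-comm)
    open CommutativeSemigroupProperties (AbelianGroup.commutativeSemigroup abelianGroup) public
      using (interchange)

  module _ {M N : ModData A} {B B′ : CommAlg A} where
    private
      module M = ModData M
      module B = CommAlg B
      module S = Tensor A M B
    open Tensor A N B′

    record IsBalanced (F : S.Tm → Tm) : Set ℓ where
      field
        ⊗-cong-F : ∀ {m m′ b b′} → m M.≈ m′ → b B.≈ b′ → F (m S.⊗ b) ∼ F (m′ S.⊗ b′)
        ⊗-addˡ-F : ∀ m m′ b → F ((m M.+ m′) S.⊗ b) ∼ F (m S.⊗ b) ⊕ F (m′ S.⊗ b)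
        ⊗-addʳ-F : ∀ m b b′ → F (m S.⊗ (b B.+ b′)) ∼ F (m S.⊗ b) ⊕ F (m S.⊗ b′)
        ⊗-bal-F  : ∀ a m b → F ((a M.· m) S.⊗ b) ∼ F (m S.⊗ (B.φ a B.* b))
        𝟘-homo   : F S.𝟘 ∼ 𝟘
        ⊕-homo   : ∀ s t → F (s S.⊕ t) ∼ F s ⊕ F t
        ⊖-homo   : ∀ s → F (S.⊖ s) ∼ ⊖ F s

    balanced-cong : ∀ {F} → IsBalanced F → ∀ {s t} → s S.∼ t → F s ∼ F t
    balanced-cong {F} F-balanced = go
      where
      open IsBalanced F-balanced

      ⊕-homo₂ : ∀ {s t s′ t′} → F s ⊕ F t ∼ F s′ ⊕ F t′ → F (s S.⊕ t) ∼ F (s′ S.⊕ t′)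
      ⊕-homo₂ {s} {t} {s′} {t′} e = ∼-trans (⊕-homo s t) (∼-trans e (∼-sym (⊕-homo s′ t′)))

      go : ∀ {s t} → s S.∼ t → F s ∼ F t
      go S.∼-refl              = ∼-refl
      go (S.∼-sym e)           = ∼-sym (go e)
      go (S.∼-trans e f)       = ∼-trans (go e) (go f)
      go (S.⊗-cong e f)        = ⊗-cong-F e f
      go (S.⊕-cong e f)        = ⊕-homo₂ (⊕-cong (go e) (go f))
      go (S.⊖-cong {s} {s′} e) = ∼-trans (⊖-homo s) (∼-trans (⊖-cong (go e)) (∼-sym (⊖-homo s′)))
      go (S.⊕-assoc s t u)     = ⊕-homo₂ (∼-trans (⊕-cong (⊕-homo s t) ∼-refl)
                                   (∼-trans (⊕-assoc _ _ _) (⊕-cong ∼-refl (∼-sym (⊕-homo t u)))))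
      go (S.⊕-comm s t)        = ⊕-homo₂ (⊕-comm _ _)
      go (S.⊕-idˡ s)           = ∼-trans (⊕-homo S.𝟘 s) (∼-trans (⊕-cong 𝟘-homo ∼-refl) (⊕-idˡ _))
      go (S.⊕-invˡ s)          = ∼-trans (⊕-homo (S.⊖ s) s)
                                   (∼-trans (⊕-cong (⊖-homo s) ∼-refl) (∼-trans (⊕-invˡ _) (∼-sym 𝟘-homo)))
      go (S.⊗-addˡ m m′ b)     = ∼-trans (⊗-addˡ-F m m′ b) (∼-sym (⊕-homo _ _))
      go (S.⊗-addʳ m b b′)     = ∼-trans (⊗-addʳ-F m b b′) (∼-sym (⊕-homo _ _))
      go (S.⊗-bal a m b)       = ⊗-bal-F a m b

  module InvolutiveTensor (R : InvAlg A) (B : CommAlg A) where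
    private
      module R = InvAlg R
      module B = CommAlg B
    open Tensor A (Rmod A R) B
    open TensorGroup (Rmod A R) B
    module P = Tensor A (R⁺mod A R) B
    open NaturalSolver B.commutativeSemiring using (solve; _:*_; _:=_)

    infixl 7 _⊛ₜ_
    _⊛ₜ_ : Tm → Tm → Tm
    _⊛ₜ_ = _⊛_ A R B

    starₜ : Tm → Tm
    starₜ = star A R B

    inclₜ : P.Tm → Tm
    inclₜ = incl A R B

    oneₜ : Tm
    oneₜ = one A R B

    B-exchange : ∀ x y z → x B.* (y B.* z) B.≈ y B.* (x B.* z)
    B-exchange = solve 3 (λ x y z → x :* (y :* z) := y :* (x :* z)) B.refl

    mulPure-balanced : ∀ r b → IsBalanced (mulPure A R B r b)
    mulPure-balanced r b = record
      { ⊗-cong-F = λ e f → ⊗-cong (R.*-congˡ e) (B.*-congˡ f)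
      ; ⊗-addˡ-F = λ m m′ b′ → ∼-trans (⊗-cong (R.distribˡ r m m′) B.refl) (⊗-addˡ _ _ _)
      ; ⊗-addʳ-F = λ m b₁ b₂ → ∼-trans (⊗-cong R.refl (B.distribˡ b b₁ b₂)) (⊗-addʳ _ _ _)
      ; ⊗-bal-F  = λ a m b′ → ∼-trans (⊗-cong (R.·-*ʳ a r m) B.refl)
                     (∼-trans (⊗-bal a (r R.* m) (b B.* b′)) (⊗-cong R.refl (B-exchange (B.φ a) b b′)))
      ; 𝟘-homo = ∼-refl ; ⊕-homo = λ _ _ → ∼-refl ; ⊖-homo = λ _ → ∼-refl }

    ⊛-congˡ : ∀ s {t t′} → t ∼ t′ → s ⊛ₜ t ∼ s ⊛ₜ t′
    ⊛-congˡ (r ⊗ b)  e = balanced-cong (mulPure-balanced r b) e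
    ⊛-congˡ 𝟘        e = ∼-refl
    ⊛-congˡ (s ⊕ s′) e = ⊕-cong (⊛-congˡ s e) (⊛-congˡ s′ e)
    ⊛-congˡ (⊖ s)    e = ⊖-cong (⊛-congˡ s e)

    mulPure-cong : ∀ {r r′ b b′} → r R.≈ r′ → b B.≈ b′ → ∀ t → mulPure A R B r b t ∼ mulPure A R B r′ b′ t
    mulPure-cong e f (m ⊗ b₁) = ⊗-cong (R.*-congʳ e) (B.*-congʳ f)
    mulPure-cong e f 𝟘        = ∼-refl
    mulPure-cong e f (s ⊕ t)  = ⊕-cong (mulPure-cong e f s) (mulPure-cong e f t)
    mulPure-cong e f (⊖ s)    = ⊖-cong (mulPure-cong e f s)

    mulPure-addˡ : ∀ r r′ b t → mulPure A R B (r R.+ r′) b t ∼ mulPure A R B r b t ⊕ mulPure A R B r′ b t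
    mulPure-addˡ r r′ b (m ⊗ b₁) = ∼-trans (⊗-cong (R.distribʳ m r r′) B.refl) (⊗-addˡ _ _ _)
    mulPure-addˡ r r′ b 𝟘        = ∼-sym (⊕-idˡ 𝟘)
    mulPure-addˡ r r′ b (s ⊕ t)  = ∼-trans (⊕-cong (mulPure-addˡ r r′ b s) (mulPure-addˡ r r′ b t)) (interchange _ _ _ _)
    mulPure-addˡ r r′ b (⊖ s)    = ∼-trans (⊖-cong (mulPure-addˡ r r′ b s)) (∼-sym (⁻¹-∙-comm _ _))

    mulPure-addʳ : ∀ r b b′ t → mulPure A R B r (b B.+ b′) t ∼ mulPure A R B r b t ⊕ mulPure A R B r b′ t
    mulPure-addʳ r b b′ (m ⊗ b₁) = ∼-trans (⊗-cong R.refl (B.distribʳ b₁ b b′)) (⊗-addʳ _ _ _)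
    mulPure-addʳ r b b′ 𝟘        = ∼-sym (⊕-idˡ 𝟘)
    mulPure-addʳ r b b′ (s ⊕ t)  = ∼-trans (⊕-cong (mulPure-addʳ r b b′ s) (mulPure-addʳ r b b′ t)) (interchange _ _ _ _)
    mulPure-addʳ r b b′ (⊖ s)    = ∼-trans (⊖-cong (mulPure-addʳ r b b′ s)) (∼-sym (⁻¹-∙-comm _ _))

    mulPure-bal : ∀ a r b t → mulPure A R B (a R.· r) b t ∼ mulPure A R B r (B.φ a B.* b) t
    mulPure-bal a r b (m ⊗ b₁) = ∼-trans (⊗-cong (R.·-*ˡ a r m) B.refl)
      (∼-trans (⊗-bal a (r R.* m) (b B.* b₁)) (⊗-cong R.refl (B.sym (B.*-assoc _ _ _))))
    mulPure-bal a r b 𝟘        = ∼-refl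
    mulPure-bal a r b (s ⊕ t)  = ⊕-cong (mulPure-bal a r b s) (mulPure-bal a r b t)
    mulPure-bal a r b (⊖ s)    = ⊖-cong (mulPure-bal a r b s)

    ⊛ₜ-balanced : ∀ t → IsBalanced (_⊛ₜ t)
    ⊛ₜ-balanced t = record
      { ⊗-cong-F = λ e f → mulPure-cong e f t
      ; ⊗-addˡ-F = λ m m′ b → mulPure-addˡ m m′ b t
      ; ⊗-addʳ-F = λ m b b′ → mulPure-addʳ m b b′ t
      ; ⊗-bal-F  = λ a m b → mulPure-bal a m b t
      ; 𝟘-homo = ∼-refl ; ⊕-homo = λ _ _ → ∼-refl ; ⊖-homo = λ _ → ∼-refl }

    ⊛-cong : ∀ {s s′ t t′} → s ∼ s′ → t ∼ t′ → s ⊛ₜ t ∼ s′ ⊛ₜ t′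
    ⊛-cong {s} {s′} {t} e f = ∼-trans (balanced-cong (⊛ₜ-balanced t) e) (⊛-congˡ s′ f)

    ⊛-zeroʳ : ∀ s → s ⊛ₜ 𝟘 ∼ 𝟘
    ⊛-zeroʳ (r ⊗ b)  = ∼-refl
    ⊛-zeroʳ 𝟘        = ∼-refl
    ⊛-zeroʳ (s ⊕ t)  = ∼-trans (⊕-cong (⊛-zeroʳ s) (⊛-zeroʳ t)) (⊕-idˡ 𝟘)
    ⊛-zeroʳ (⊖ s)    = ∼-trans (⊖-cong (⊛-zeroʳ s)) ε⁻¹≈ε

    ⊛-distribˡ : ∀ s t u → s ⊛ₜ (t ⊕ u) ∼ s ⊛ₜ t ⊕ s ⊛ₜ u
    ⊛-distribˡ (r ⊗ b)  t u = ∼-refl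
    ⊛-distribˡ 𝟘        t u = ∼-sym (⊕-idˡ 𝟘)
    ⊛-distribˡ (s ⊕ s′) t u = ∼-trans (⊕-cong (⊛-distribˡ s t u) (⊛-distribˡ s′ t u)) (interchange _ _ _ _)
    ⊛-distribˡ (⊖ s)    t u = ∼-trans (⊖-cong (⊛-distribˡ s t u)) (∼-sym (⁻¹-∙-comm _ _))

    ⊛-negʳ : ∀ s t → s ⊛ₜ (⊖ t) ∼ ⊖ (s ⊛ₜ t)
    ⊛-negʳ (r ⊗ b)  t = ∼-refl
    ⊛-negʳ 𝟘        t = ∼-sym ε⁻¹≈ε
    ⊛-negʳ (s ⊕ s′) t = ∼-trans (⊕-cong (⊛-negʳ s t) (⊛-negʳ s′ t)) (⁻¹-∙-comm _ _)
    ⊛-negʳ (⊖ s)    t = ⊖-cong (⊛-negʳ s t)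

    mulPure-mulPure : ∀ r b r′ b′ u → mulPure A R B (r R.* r′) (b B.* b′) u ∼ mulPure A R B r b (mulPure A R B r′ b′ u)
    mulPure-mulPure r b r′ b′ (m ⊗ b₁) = ⊗-cong (R.*-assoc _ _ _) (B.*-assoc _ _ _)
    mulPure-mulPure r b r′ b′ 𝟘        = ∼-refl
    mulPure-mulPure r b r′ b′ (s ⊕ t)  = ⊕-cong (mulPure-mulPure r b r′ b′ s) (mulPure-mulPure r b r′ b′ t)
    mulPure-mulPure r b r′ b′ (⊖ s)    = ⊖-cong (mulPure-mulPure r b r′ b′ s)

    mulPure-⊛ : ∀ r b t u → mulPure A R B r b t ⊛ₜ u ∼ mulPure A R B r b (t ⊛ₜ u)
    mulPure-⊛ r b (r′ ⊗ b′) u = mulPure-mulPure r b r′ b′ u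
    mulPure-⊛ r b 𝟘         u = ∼-refl
    mulPure-⊛ r b (s ⊕ t)   u = ⊕-cong (mulPure-⊛ r b s u) (mulPure-⊛ r b t u)
    mulPure-⊛ r b (⊖ s)     u = ⊖-cong (mulPure-⊛ r b s u)

    ⊛-assoc : ∀ s t u → (s ⊛ₜ t) ⊛ₜ u ∼ s ⊛ₜ (t ⊛ₜ u)
    ⊛-assoc (r ⊗ b)  t u = mulPure-⊛ r b t u
    ⊛-assoc 𝟘        t u = ∼-refl
    ⊛-assoc (s ⊕ s′) t u = ⊕-cong (⊛-assoc s t u) (⊛-assoc s′ t u)
    ⊛-assoc (⊖ s)    t u = ⊖-cong (⊛-assoc s t u)

    ⊛-identityˡ : ∀ s → oneₜ ⊛ₜ s ∼ s
    ⊛-identityˡ (r ⊗ b) = ⊗-cong (R.*-identityˡ r) (B.*-identityˡ b)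
    ⊛-identityˡ 𝟘       = ∼-refl
    ⊛-identityˡ (s ⊕ t) = ⊕-cong (⊛-identityˡ s) (⊛-identityˡ t)
    ⊛-identityˡ (⊖ s)   = ⊖-cong (⊛-identityˡ s)

    ⊛-identityʳ : ∀ s → s ⊛ₜ oneₜ ∼ s
    ⊛-identityʳ (r ⊗ b) = ⊗-cong (R.*-identityʳ r) (B.*-identityʳ b)
    ⊛-identityʳ 𝟘       = ∼-refl
    ⊛-identityʳ (s ⊕ t) = ⊕-cong (⊛-identityʳ s) (⊛-identityʳ t)
    ⊛-identityʳ (⊖ s)   = ⊖-cong (⊛-identityʳ s)

    star-balanced : IsBalanced starₜ
    star-balanced = record
      { ⊗-cong-F = λ e f → ⊗-cong (R.⋆-cong e) f
      ; ⊗-addˡ-F = λ m m′ b → ∼-trans (⊗-cong (R.⋆-+ m m′) B.refl) (⊗-addˡ _ _ _)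
      ; ⊗-addʳ-F = λ m b b′ → ⊗-addʳ _ _ _
      ; ⊗-bal-F  = λ a m b → ∼-trans (⊗-cong (R.⋆-· a m) B.refl) (⊗-bal _ _ _)
      ; 𝟘-homo = ∼-refl ; ⊕-homo = λ _ _ → ∼-refl ; ⊖-homo = λ _ → ∼-refl }

    star-cong : ∀ {s s′} → s ∼ s′ → starₜ s ∼ starₜ s′
    star-cong = balanced-cong star-balanced

    star-involutive : ∀ s → starₜ (starₜ s) ∼ s
    star-involutive (r ⊗ b) = ⊗-cong (R.⋆-invol r) B.refl
    star-involutive 𝟘       = ∼-refl
    star-involutive (s ⊕ t) = ⊕-cong (star-involutive s) (star-involutive t)
    star-involutive (⊖ s)   = ⊖-cong (star-involutive s)

    star-mulPure : ∀ r b t → starₜ (mulPure A R B r b t) ∼ starₜ t ⊛ₜ ((r R.⋆) ⊗ b)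
    star-mulPure r b (r′ ⊗ b′) = ⊗-cong (R.⋆-* r r′) (B.*-comm b b′)
    star-mulPure r b 𝟘         = ∼-refl
    star-mulPure r b (s ⊕ t)   = ⊕-cong (star-mulPure r b s) (star-mulPure r b t)
    star-mulPure r b (⊖ s)     = ⊖-cong (star-mulPure r b s)

    star-⊛ : ∀ s t → starₜ (s ⊛ₜ t) ∼ starₜ t ⊛ₜ starₜ s
    star-⊛ (r ⊗ b)  t = star-mulPure r b t
    star-⊛ 𝟘        t = ∼-sym (⊛-zeroʳ (starₜ t))
    star-⊛ (s ⊕ s′) t = ∼-trans (⊕-cong (star-⊛ s t) (star-⊛ s′ t)) (∼-sym (⊛-distribˡ (starₜ t) _ _))
    star-⊛ (⊖ s)    t = ∼-trans (⊖-cong (star-⊛ s t)) (∼-sym (⊛-negʳ (starₜ t) _))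

    incl-balanced : IsBalanced inclₜ
    incl-balanced = record
      { ⊗-cong-F = ⊗-cong
      ; ⊗-addˡ-F = λ _ _ _ → ⊗-addˡ _ _ _
      ; ⊗-addʳ-F = λ _ _ _ → ⊗-addʳ _ _ _
      ; ⊗-bal-F  = λ _ _ _ → ⊗-bal _ _ _
      ; 𝟘-homo = ∼-refl ; ⊕-homo = λ _ _ → ∼-refl ; ⊖-homo = λ _ → ∼-refl }

    incl-cong : ∀ {y y′} → y P.∼ y′ → inclₜ y ∼ inclₜ y′
    incl-cong = balanced-cong incl-balanced

    star-incl : ∀ y → starₜ (inclₜ y) ∼ inclₜ y
    star-incl (m P.⊗ b) = ⊗-cong (proj₂ m) B.refl
    star-incl P.𝟘       = ∼-refl
    star-incl (s P.⊕ t) = ⊕-cong (star-incl s) (star-incl t)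
    star-incl (P.⊖ s)   = ⊖-cong (star-incl s)

    star-one : starₜ oneₜ ∼ oneₜ
    star-one = star-incl (one⁺ A R B)

    star-sandwich : ∀ s q → starₜ q ∼ q → starₜ ((s ⊛ₜ q) ⊛ₜ starₜ s) ∼ (s ⊛ₜ q) ⊛ₜ starₜ s
    star-sandwich s q q⋆∼q =
      ∼-trans (star-⊛ (s ⊛ₜ q) (starₜ s))
      (∼-trans (⊛-cong (star-involutive s) (star-⊛ s q))
      (∼-trans (⊛-congˡ s (balanced-cong (⊛ₜ-balanced (starₜ s)) q⋆∼q))
      (∼-sym (⊛-assoc s q (starₜ s)))))

    ⊙-cong : ∀ {b b′} → b B.≈ b′ → ∀ s → b ⊙ s ∼ b′ ⊙ s
    ⊙-cong e (m ⊗ b₁) = ⊗-cong R.refl (B.*-congʳ e)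
    ⊙-cong e 𝟘        = ∼-refl
    ⊙-cong e (s ⊕ t)  = ⊕-cong (⊙-cong e s) (⊙-cong e t)
    ⊙-cong e (⊖ s)    = ⊖-cong (⊙-cong e s)

    ⊙-balanced : ∀ b → IsBalanced (b ⊙_)
    ⊙-balanced b = record
      { ⊗-cong-F = λ e f → ⊗-cong e (B.*-congˡ f)
      ; ⊗-addˡ-F = λ _ _ _ → ⊗-addˡ _ _ _
      ; ⊗-addʳ-F = λ m b₁ b₂ → ∼-trans (⊗-cong R.refl (B.distribˡ b b₁ b₂)) (⊗-addʳ _ _ _)
      ; ⊗-bal-F  = λ a m b′ → ∼-trans (⊗-bal a m (b B.* b′)) (⊗-cong R.refl (B-exchange (B.φ a) b b′))
      ; 𝟘-homo = ∼-refl ; ⊕-homo = λ _ _ → ∼-refl ; ⊖-homo = λ _ → ∼-refl }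

    ⊙-congʳ : ∀ b {s s′} → s ∼ s′ → b ⊙ s ∼ b ⊙ s′
    ⊙-congʳ b = balanced-cong (⊙-balanced b)

    ⊙-distribʳ : ∀ b b′ s → (b B.+ b′) ⊙ s ∼ b ⊙ s ⊕ b′ ⊙ s
    ⊙-distribʳ b b′ (m ⊗ b₁) = ∼-trans (⊗-cong R.refl (B.distribʳ b₁ b b′)) (⊗-addʳ _ _ _)
    ⊙-distribʳ b b′ 𝟘        = ∼-sym (⊕-idˡ 𝟘)
    ⊙-distribʳ b b′ (s ⊕ t)  = ∼-trans (⊕-cong (⊙-distribʳ b b′ s) (⊙-distribʳ b b′ t)) (interchange _ _ _ _)
    ⊙-distribʳ b b′ (⊖ s)    = ∼-trans (⊖-cong (⊙-distribʳ b b′ s)) (∼-sym (⁻¹-∙-comm _ _))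

    ⊙-identity : ∀ s → B.1# ⊙ s ∼ s
    ⊙-identity (m ⊗ b) = ⊗-cong R.refl (B.*-identityˡ b)
    ⊙-identity 𝟘       = ∼-refl
    ⊙-identity (s ⊕ t) = ⊕-cong (⊙-identity s) (⊙-identity t)
    ⊙-identity (⊖ s)   = ⊖-cong (⊙-identity s)

    ⊗-zeroʳ : ∀ m → (m ⊗ B.0#) ∼ 𝟘
    ⊗-zeroʳ m = identityˡ-unique (m ⊗ B.0#) (m ⊗ B.0#)
      (∼-trans (∼-sym (⊗-addʳ m B.0# B.0#)) (⊗-cong R.refl (B.+-identityˡ B.0#)))

    ⊙-zero : ∀ s → B.0# ⊙ s ∼ 𝟘
    ⊙-zero (m ⊗ b) = ∼-trans (⊗-cong R.refl (B.zeroˡ b)) (⊗-zeroʳ m)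
    ⊙-zero 𝟘       = ∼-refl
    ⊙-zero (s ⊕ t) = ∼-trans (⊕-cong (⊙-zero s) (⊙-zero t)) (⊕-idˡ 𝟘)
    ⊙-zero (⊖ s)   = ∼-trans (⊖-cong (⊙-zero s)) ε⁻¹≈ε

  module Symmetrisation (R : InvAlg A) (B : CommAlg A) (½ : A.Carrier) (½-spec : CommutativeRingFacts.IsHalf A ½) where
    private
      module R = InvAlg R
      module B = CommAlg B
      module φ = RingMorphisms.IsRingHomomorphism B.φ-hom
    open Tensor A (Rmod A R) B
    open TensorGroup (Rmod A R) B
    open InvolutiveTensor R B
    open CommutativeSemigroupProperties (AbelianGroup.commutativeSemigroup (Ring.+-abelianGroup R.ring))
      using () renaming (interchange to R-interchange)

    symₜ : Tm → P.Tm
    symₜ = symm A R B ½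

    ½+½≈1 : ½ A.+ ½ A.≈ A.1#
    ½+½≈1 = A.trans (A.sym (A.+-cong (A.*-identityʳ ½) (A.*-identityʳ ½))) (A.trans (A.sym (A.distribˡ ½ A.1# A.1#)) ½-spec)

    φ½+φ½≈1 : B.φ ½ B.+ B.φ ½ B.≈ B.1#
    φ½+φ½≈1 = B.trans (B.sym (φ.+-homo ½ ½)) (B.trans (φ.⟦⟧-cong ½+½≈1) φ.1#-homo)

    φ½-spec : CommutativeRingFacts.IsHalf B.ring (B.φ ½)
    φ½-spec = B.trans (B.distribˡ (B.φ ½) B.1# B.1#)
      (B.trans (B.+-cong (B.*-identityʳ (B.φ ½)) (B.*-identityʳ (B.φ ½))) φ½+φ½≈1)

    symmetrised : R.Carrier → Sym A R
    symmetrised r = ½ R.· (r R.+ r R.⋆) , R.trans (R.⋆-· ½ (r R.+ r R.⋆))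
      (R.·-cong A.refl (R.trans (R.⋆-+ r (r R.⋆)) (R.trans (R.+-congˡ (R.⋆-invol r)) (R.+-comm (r R.⋆) r))))

    symmetrised-fixed : ∀ x → x R.⋆ R.≈ x → ½ R.· (x R.+ x R.⋆) R.≈ x
    symmetrised-fixed x x⋆≈x = R.trans (R.·-cong A.refl (R.+-congˡ x⋆≈x))
      (R.trans (R.·-distˡ ½ x x) (R.trans (R.sym (R.·-distʳ ½ ½ x)) (R.trans (R.·-cong ½+½≈1 R.refl) (R.·-identity x))))

    symmetrised-+ : ∀ m m′ → ½ R.· ((m R.+ m′) R.+ (m R.+ m′) R.⋆) R.≈ ½ R.· (m R.+ m R.⋆) R.+ ½ R.· (m′ R.+ m′ R.⋆)
    symmetrised-+ m m′ = R.trans (R.·-cong A.refl (R.trans (R.+-congˡ (R.⋆-+ m m′)) (R-interchange m m′ (m R.⋆) (m′ R.⋆))))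
      (R.·-distˡ ½ _ _)

    symmetrised-· : ∀ a m → ½ R.· ((a R.· m) R.+ (a R.· m) R.⋆) R.≈ a R.· (½ R.· (m R.+ m R.⋆))
    symmetrised-· a m = R.trans (R.·-cong A.refl (R.trans (R.+-congˡ (R.⋆-· a m)) (R.sym (R.·-distˡ a m (m R.⋆)))))
      (R.trans (R.sym (R.·-assoc ½ a _)) (R.trans (R.·-cong (A.*-comm ½ a) R.refl) (R.·-assoc a ½ _)))

    symm-balanced : IsBalanced symₜ
    symm-balanced = record
      { ⊗-cong-F = λ e f → P.⊗-cong (R.·-cong A.refl (R.+-cong e (R.⋆-cong e))) f
      ; ⊗-addˡ-F = λ m m′ b → P.∼-trans (P.⊗-cong (symmetrised-+ m m′) B.refl) (P.⊗-addˡ (symmetrised m) (symmetrised m′) b)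
      ; ⊗-addʳ-F = λ _ _ _ → P.⊗-addʳ _ _ _
      ; ⊗-bal-F  = λ a m b → P.∼-trans (P.⊗-cong (symmetrised-· a m) B.refl) (P.⊗-bal a (symmetrised m) b)
      ; 𝟘-homo = P.∼-refl ; ⊕-homo = λ _ _ → P.∼-refl ; ⊖-homo = λ _ → P.∼-refl }

    symm-cong : ∀ {s s′} → s ∼ s′ → symₜ s P.∼ symₜ s′
    symm-cong = balanced-cong symm-balanced

    symm-incl : ∀ y → symₜ (inclₜ y) P.∼ y
    symm-incl (m P.⊗ b) = P.⊗-cong (symmetrised-fixed (proj₁ m) (proj₂ m)) B.refl
    symm-incl P.𝟘       = P.∼-refl
    symm-incl (s P.⊕ t) = P.⊕-cong (symm-incl s) (symm-incl t)
    symm-incl (P.⊖ s)   = P.⊖-cong (symm-incl s)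

    incl-symm : ∀ s → inclₜ (symₜ s) ∼ B.φ ½ ⊙ s ⊕ B.φ ½ ⊙ starₜ s
    incl-symm (r ⊗ b) = ∼-trans (⊗-cong (R.·-distˡ ½ r (r R.⋆)) B.refl)
      (∼-trans (⊗-addˡ _ _ _) (⊕-cong (⊗-bal ½ r b) (⊗-bal ½ (r R.⋆) b)))
    incl-symm 𝟘       = ∼-sym (⊕-idˡ 𝟘)
    incl-symm (s ⊕ t) = ∼-trans (⊕-cong (incl-symm s) (incl-symm t)) (interchange _ _ _ _)
    incl-symm (⊖ s)   = ∼-trans (⊖-cong (incl-symm s)) (∼-sym (⁻¹-∙-comm _ _))

    incl-symm-fixed : ∀ s → starₜ s ∼ s → inclₜ (symₜ s) ∼ s
    incl-symm-fixed s s⋆∼s =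
      ∼-trans (incl-symm s) (∼-trans (⊕-cong ∼-refl (⊙-congʳ (B.φ ½) s⋆∼s))
      (∼-trans (∼-sym (⊙-distribʳ (B.φ ½) (B.φ ½) s)) (∼-trans (⊙-cong φ½+φ½≈1 s) (⊙-identity s))))

    conj : Tm → P.Tm → P.Tm
    conj x y = symₜ ((x ⊛ₜ inclₜ y) ⊛ₜ starₜ x)

    conj-cong : ∀ {x x′ y y′} → x ∼ x′ → y P.∼ y′ → conj x y P.∼ conj x′ y′
    conj-cong e f = symm-cong (⊛-cong (⊛-cong e (incl-cong f)) (star-cong e))

    incl-conj : ∀ x y → inclₜ (conj x y) ∼ (x ⊛ₜ inclₜ y) ⊛ₜ starₜ x
    incl-conj x y = incl-symm-fixed _ (star-sandwich x (inclₜ y) (star-incl y))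

    conj-one : ∀ y → conj oneₜ y P.∼ y
    conj-one y = P.∼-trans (symm-cong (∼-trans (⊛-cong (⊛-identityˡ (inclₜ y)) star-one) (⊛-identityʳ (inclₜ y))))
                           (symm-incl y)

  baseChange-retraction : (M : ModData A) → (∀ {m} → ModData._≈_ M m m) → {B B′ : CommAlg A}
    (h : AlgHom A B B′) (g : AlgHom A B′ B) → (∀ b → CommAlg._≈_ B (AlgHom.f g (AlgHom.f h b)) b) →
    ∀ s → Tensor._∼_ A M B (baseChange A M g (baseChange A M h s)) s
  baseChange-retraction M M-refl h g g∘h≈id = go
    where
    open Tensor A M _
    go : ∀ s → baseChange A M g (baseChange A M h s) ∼ s
    go (m ⊗ b) = ⊗-cong M-refl (g∘h≈id b)
    go 𝟘       = ∼-refl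
    go (s ⊕ t) = ⊕-cong (go s) (go t)
    go (⊖ s)   = ⊖-cong (go s)

  module BaseChange (R : InvAlg A) {B B′ : CommAlg A} (h : AlgHom A B B′) where
    private
      module R = InvAlg R
      module h = RingMorphisms.IsRingHomomorphism (AlgHom.f-hom h)
      module S = Tensor A (Rmod A R) B
      module S⁺ = Tensor A (R⁺mod A R) B
      module I = InvolutiveTensor R B
    open Tensor A (Rmod A R) B′
    open InvolutiveTensor R B′
    open AlgHom h using (f)

    bc : S.Tm → Tm
    bc = baseChange A (Rmod A R) h

    bc⁺ : S⁺.Tm → P.Tm
    bc⁺ = baseChange A (R⁺mod A R) h

    bc-mulPure : ∀ r b t → bc (mulPure A R B r b t) ∼ mulPure A R B′ r (f b) (bc t)
    bc-mulPure r b (m S.⊗ b₁) = ⊗-cong R.refl (h.*-homo b b₁)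
    bc-mulPure r b S.𝟘        = ∼-refl
    bc-mulPure r b (s S.⊕ t)  = ⊕-cong (bc-mulPure r b s) (bc-mulPure r b t)
    bc-mulPure r b (S.⊖ s)    = ⊖-cong (bc-mulPure r b s)

    bc-⊛ : ∀ s t → bc (s I.⊛ₜ t) ∼ bc s ⊛ₜ bc t
    bc-⊛ (r S.⊗ b)  t = bc-mulPure r b t
    bc-⊛ S.𝟘        t = ∼-refl
    bc-⊛ (s S.⊕ s′) t = ⊕-cong (bc-⊛ s t) (bc-⊛ s′ t)
    bc-⊛ (S.⊖ s)    t = ⊖-cong (bc-⊛ s t)

    bc-star : ∀ s → bc (I.starₜ s) ∼ starₜ (bc s)
    bc-star (r S.⊗ b) = ∼-refl
    bc-star S.𝟘       = ∼-refl
    bc-star (s S.⊕ t) = ⊕-cong (bc-star s) (bc-star t)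
    bc-star (S.⊖ s)   = ⊖-cong (bc-star s)

    bc-incl : ∀ y → bc (I.inclₜ y) ∼ inclₜ (bc⁺ y)
    bc-incl (m S⁺.⊗ b) = ∼-refl
    bc-incl S⁺.𝟘       = ∼-refl
    bc-incl (s S⁺.⊕ t) = ⊕-cong (bc-incl s) (bc-incl t)
    bc-incl (S⁺.⊖ s)   = ⊖-cong (bc-incl s)

    bc-symm : ∀ ½ s → bc⁺ (symm A R B ½ s) P.∼ symm A R B′ ½ (bc s)
    bc-symm ½ (r S.⊗ b) = P.∼-refl
    bc-symm ½ S.𝟘       = P.∼-refl
    bc-symm ½ (s S.⊕ t) = P.⊕-cong (bc-symm ½ s) (bc-symm ½ t)
    bc-symm ½ (S.⊖ s)   = P.⊖-cong (bc-symm ½ s)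

    bc-⊙ : ∀ b s → bc (b S.⊙ s) ∼ f b ⊙ bc s
    bc-⊙ b (m S.⊗ b₁) = ⊗-cong R.refl (h.*-homo b b₁)
    bc-⊙ b S.𝟘        = ∼-refl
    bc-⊙ b (s S.⊕ t)  = ⊕-cong (bc-⊙ b s) (bc-⊙ b t)
    bc-⊙ b (S.⊖ s)    = ⊖-cong (bc-⊙ b s)

    bc-one : bc I.oneₜ ∼ oneₜ
    bc-one = ⊗-cong R.refl h.1#-homo

    bc-conj : ∀ ½ ½-spec x y →
      bc⁺ (Symmetrisation.conj R B ½ ½-spec x y) P.∼ Symmetrisation.conj R B′ ½ ½-spec (bc x) (bc⁺ y)
    bc-conj ½ ½-spec x y = P.∼-trans (bc-symm ½ _) (symm-cong (∼-trans (bc-⊛ (x I.⊛ₜ I.inclₜ y) (I.starₜ x))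
      (⊛-cong (∼-trans (bc-⊛ x (I.inclₜ y)) (⊛-congˡ (bc x) (bc-incl y))) (bc-star x))))
      where
      open Symmetrisation R B′ ½ ½-spec using (symm-cong)

module PolynomialAlgebra {ℓ : Level} {A : CommutativeRing ℓ ℓ} (B : CommAlg A) where
  private module B = CommAlg B
  open Polynomials (CommAlg.ring B) public

  constantIsRingHomomorphism :
    RingMorphisms.IsRingHomomorphism B.rawRing (CommutativeRing.rawRing polynomialRing) (_∷ [])
  constantIsRingHomomorphism = mkIsRingHomomorphism (λ e → ∷-cong e ≋-refl) (λ _ _ → ≋-refl)
    (λ _ _ → ∷-cong (B.sym (B.+-identityʳ _)) ≋-refl) (mk λ { zero → B.refl ; (suc n) → B.refl })
    ≋-refl (λ _ → ≋-refl)

  B[T] : CommAlg A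
  B[T] = record
    { ring  = polynomialRing
    ; φ     = λ a → B.φ a ∷ []
    ; φ-hom = Composition.isRingHomomorphism ≋-trans B.φ-hom constantIsRingHomomorphism }

  constant : AlgHom A B B[T]
  constant = record { f = _∷ [] ; f-hom = constantIsRingHomomorphism ; f-φ = λ _ → ≋-refl }

  evaluation : B.Carrier → AlgHom A B[T] B
  evaluation x = record
    { f = eval x ; f-hom = evalIsRingHomomorphism x ; f-φ = λ a → eval-constant x (B.φ a) }

module DeterminantLaw {ℓ : Level} (A : CommutativeRing ℓ ℓ) (½ : CommutativeRing.Carrier A)
  (½-spec : CommutativeRingFacts.IsHalf A ½)
  (R : InvAlg A) {d : ℕ} (DP : WeakSympDetLaw A R d) where
  open WeakSympDetLaw DP
  open TensorProducts A

  det : (B : CommAlg A) → Tensor.Tm A (Rmod A R) B → CommAlg.Carrier B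
  det = HomPolyLaw.law D

  pf : (B : CommAlg A) → Tensor.Tm A (R⁺mod A R) B → CommAlg.Carrier B
  pf = HomPolyLaw.law P

  module _ (B : CommAlg A) where
    open CommAlg B
    open Symmetrisation R B ½ ½-spec
    open InvolutiveTensor R B
    open NaturalSolver commutativeSemiring
    open SetoidReasoning setoid

    pf-conj-squared : ∀ x y → pf B (conj x y) * pf B (conj x y) ≈ (det B x * pf B y) * (det B x * pf B y)
    pf-conj-squared x y = begin
      pf B (conj x y) * pf B (conj x y)                ≈⟨ P-sq B (conj x y) ⟩
      det B (inclₜ (conj x y))                         ≈⟨ HomPolyLaw.law-cong D B (incl-conj x y) ⟩
      det B ((x ⊛ₜ inclₜ y) ⊛ₜ starₜ x)               ≈⟨ D-mult B (x ⊛ₜ inclₜ y) (starₜ x) ⟩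
      det B (x ⊛ₜ inclₜ y) * det B (starₜ x)          ≈⟨ *-cong (D-mult B x (inclₜ y)) (D-star B x) ⟩
      (det B x * det B (inclₜ y)) * det B x            ≈⟨ *-congʳ (*-congˡ (sym (P-sq B y))) ⟩
      (det B x * (pf B y * pf B y)) * det B x          ≈⟨ solve 2 (λ a b → (a :* (b :* b)) :* a := (a :* b) :* (a :* b)) refl (det B x) (pf B y) ⟩
      (det B x * pf B y) * (det B x * pf B y)          ∎

module Deformation {ℓ : Level} (A : CommutativeRing ℓ ℓ) (½ : CommutativeRing.Carrier A)
  (½-spec : CommutativeRingFacts.IsHalf A ½)
  (R : InvAlg A) {d : ℕ} (DP : WeakSympDetLaw A R d)
  (B : CommAlg A) (x : Tensor.Tm A (Rmod A R) B) (y : Tensor.Tm A (R⁺mod A R) B) where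
  private
    module B = CommAlg B
    module R = InvAlg R
  open PolynomialAlgebra B
  open TensorProducts A
  open DeterminantLaw A ½ ½-spec R DP
  open WeakSympDetLaw DP
  open Tensor A (Rmod A R) B
  open TensorGroup (Rmod A R) B
  open InvolutiveTensor R B
  open Symmetrisation R B ½ ½-spec
  module S = Tensor A (Rmod A R) B[T]
  module IC = InvolutiveTensor R B[T]
  module SC = Symmetrisation R B[T] ½ ½-spec
  module At (c : B.Carrier) = BaseChange R (evaluation c)
  open SetoidReasoning B.setoid

  segment : S.Tm
  segment = (1ₚ ⊞ ⊟ T) S.⊙ IC.oneₜ S.⊕ T S.⊙ baseChange A (Rmod A R) constant x

  ỹ : IC.P.Tm
  ỹ = baseChange A (R⁺mod A R) constant y

  x-at : ∀ c → At.bc c (baseChange A (Rmod A R) constant x) ∼ x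
  x-at c = baseChange-retraction (Rmod A R) R.refl constant (evaluation c) (eval-constant c) x

  ỹ-at : ∀ c → At.bc⁺ c ỹ P.∼ y
  ỹ-at c = baseChange-retraction (R⁺mod A R) R.refl constant (evaluation c) (eval-constant c) y

  segment-at : ∀ c → At.bc c segment ∼ (B.1# B.- c) ⊙ oneₜ ⊕ c ⊙ x
  segment-at c = ⊕-cong
    (∼-trans (At.bc-⊙ c (1ₚ ⊞ ⊟ T) IC.oneₜ) (∼-trans (⊙-cong eval-1-T (At.bc c IC.oneₜ)) (⊙-congʳ _ (At.bc-one c))))
    (∼-trans (At.bc-⊙ c T _) (∼-trans (⊙-cong (eval-T c) _) (⊙-congʳ c (x-at c))))
    where
    eval-1-T : eval c (1ₚ ⊞ ⊟ T) B.≈ B.1# B.- c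
    eval-1-T = B.trans (eval-⊞ c 1ₚ (⊟ T)) (B.+-cong (eval-constant c B.1#) (B.trans (eval-⊟ c T) (B.-‿cong (eval-T c))))

  segment-at-0 : At.bc B.0# segment ∼ oneₜ
  segment-at-0 = ∼-trans (segment-at B.0#) (∼-trans
    (⊕-cong (∼-trans (⊙-cong 1-0≈1 oneₜ) (⊙-identity oneₜ)) (⊙-zero x)) (⊕-idʳ oneₜ))
    where
    1-0≈1 : B.1# B.- B.0# B.≈ B.1#
    1-0≈1 = B.trans (B.+-congˡ (GroupProperties.ε⁻¹≈ε B.+-group)) (B.+-identityʳ B.1#)

  segment-at-1 : At.bc B.1# segment ∼ x
  segment-at-1 = ∼-trans (segment-at B.1#) (∼-trans
    (⊕-cong (∼-trans (⊙-cong (B.-‿inverseʳ B.1#) oneₜ) (⊙-zero oneₜ)) (⊙-identity x)) (⊕-idˡ x))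

  deformedLhs deformedRhs : Poly
  deformedLhs = pf B[T] (SC.conj segment ỹ)
  deformedRhs = det B[T] segment ⊠ pf B[T] ỹ

  deformedLhs-at : ∀ c → eval c deformedLhs B.≈ pf B (conj (At.bc c segment) y)
  deformedLhs-at c = begin
    eval c deformedLhs                            ≈⟨ HomPolyLaw.natural P (evaluation c) (SC.conj segment ỹ) ⟨
    pf B (At.bc⁺ c (SC.conj segment ỹ))           ≈⟨ HomPolyLaw.law-cong P B (At.bc-conj c ½ ½-spec segment ỹ) ⟩
    pf B (conj (At.bc c segment) (At.bc⁺ c ỹ))    ≈⟨ HomPolyLaw.law-cong P B (conj-cong (∼-refl {At.bc c segment}) (ỹ-at c)) ⟩
    pf B (conj (At.bc c segment) y)               ∎

  deformedRhs-at : ∀ c → eval c deformedRhs B.≈ det B (At.bc c segment) B.* pf B y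
  deformedRhs-at c = B.trans (eval-⊠ c (det B[T] segment) (pf B[T] ỹ)) (B.*-cong (B.sym (HomPolyLaw.natural D (evaluation c) segment))
    (B.trans (B.sym (HomPolyLaw.natural P (evaluation c) ỹ)) (HomPolyLaw.law-cong P B (ỹ-at c))))

  deformedLhs-at-0 : coeff deformedLhs zero B.≈ pf B y
  deformedLhs-at-0 = begin
    coeff deformedLhs zero                  ≈⟨ eval-0# deformedLhs ⟨
    eval B.0# deformedLhs                   ≈⟨ deformedLhs-at B.0# ⟩
    pf B (conj (At.bc B.0# segment) y)      ≈⟨ HomPolyLaw.law-cong P B (P.∼-trans (conj-cong segment-at-0 P.∼-refl) (conj-one y)) ⟩
    pf B y                                  ∎

  deformedRhs-at-0 : coeff deformedRhs zero B.≈ pf B y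
  deformedRhs-at-0 = begin
    coeff deformedRhs zero                      ≈⟨ eval-0# deformedRhs ⟨
    eval B.0# deformedRhs                       ≈⟨ deformedRhs-at B.0# ⟩
    det B (At.bc B.0# segment) B.* pf B y       ≈⟨ B.*-congʳ (B.trans (HomPolyLaw.law-cong D B segment-at-0) (D-one B)) ⟩
    B.1# B.* pf B y                             ≈⟨ B.*-identityˡ (pf B y) ⟩
    pf B y                                      ∎

  deformedLhs≋deformedRhs : CommutativeRingFacts.NonZeroDivisor B.ring (pf B y) → deformedLhs ≋ deformedRhs
  deformedLhs≋deformedRhs pf-y-regular = ⊠-square-injective
    (CommutativeRingFacts.IsHalf⇒NonZeroDivisor-2 B.ring φ½-spec) deformedLhs deformedRhs
    (CommutativeRingFacts.NonZeroDivisor-resp B.ring (B.sym deformedLhs-at-0) pf-y-regular)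
    (B.trans deformedLhs-at-0 (B.sym deformedRhs-at-0))
    (pf-conj-squared B[T] segment ỹ)

lemma3p18 : {ℓ : Level} (A : CommutativeRing ℓ ℓ)
    → (two⁻¹ : Σ (CommutativeRing.Carrier A) (λ h →
         CommutativeRing._≈_ A
           (CommutativeRing._*_ A h (CommutativeRing._+_ A (CommutativeRing.1# A) (CommutativeRing.1# A)))
           (CommutativeRing.1# A)))
    → (R : InvAlg A) (d : ℕ) (DP : WeakSympDetLaw A R d)
    → (B : CommAlg A)
    → (x : Tensor.Tm A (Rmod A R) B)
    → (y : Tensor.Tm A (R⁺mod A R) B)
    → (∀ (b : CommAlg.Carrier B) →
         CommAlg._≈_ B (CommAlg._*_ B (HomPolyLaw.law (WeakSympDetLaw.P DP) B y) b) (CommAlg.0# B) →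
         CommAlg._≈_ B b (CommAlg.0# B))
    → CommAlg._≈_ B
        (HomPolyLaw.law (WeakSympDetLaw.P DP) B
          (symm A R B (proj₁ two⁻¹) (_⊛_ A R B (_⊛_ A R B x (incl A R B y)) (star A R B x))))
        (CommAlg._*_ B (HomPolyLaw.law (WeakSympDetLaw.D DP) B x) (HomPolyLaw.law (WeakSympDetLaw.P DP) B y))
lemma3p18 A (½ , ½-spec) R d DP B x y pf-y-regular = begin
  pf B (conj x y)                                 ≈⟨ HomPolyLaw.law-cong P B (conj-cong (∼-sym segment-at-1) P.∼-refl) ⟩
  pf B (conj (At.bc 1# segment) y)                ≈⟨ deformedLhs-at 1# ⟨
  eval 1# deformedLhs                             ≈⟨ eval-cong 1# (deformedLhs≋deformedRhs pf-y-regular) ⟩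
  eval 1# deformedRhs                             ≈⟨ deformedRhs-at 1# ⟩
  det B (At.bc 1# segment) * pf B y               ≈⟨ *-congʳ (HomPolyLaw.law-cong D B segment-at-1) ⟩
  det B x * pf B y                                ∎
  where
  open CommAlg B
  open WeakSympDetLaw DP
  open Deformation A ½ ½-spec R DP B x y
  open TensorProducts A
  open InvolutiveTensor R B using (module P)
  open Tensor A (Rmod A R) B using (∼-sym)
  open Symmetrisation R B ½ ½-spec using (conj; conj-cong)
  open DeterminantLaw A ½ ½-spec R DP using (det; pf)
  open PolynomialAlgebra B using (eval; eval-cong)
  open SetoidReasoning setoid
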